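{- Let $M$ be an $n\times n$ partially defined integer matrix whose entries $M[i,j]$ are defined exactly for $i\ge j$ (lower triangular case), respectively exactly for $i\le j$ (upper triangular case), such that $M[i+1,j]-M[i,j]\in\{ -1,0,1\}$ whenever both entries are defined, and $M[i+1,j]-M[i,j]\le M[i+1,j+1]-M[i,j+1]$ whenever all four entries are defined. Then the undefined entries of $M$ can be assigned integer values so that the resulting full $n\times n$ matrix is unit-Monge.
   Context: A full $n\times n$ integer matrix $M$ is unit-Monge if for all $1\le i<n$, $1\le j<n$ one has $M[i+1,j]-M[i,j]\le M[i+1,j+1]-M[i,j+1]$, and for all $1\le i<n$, $1\le j\le n$ one has $M[i+1,j]-M[i,j]\in\{ -1,0,1\}$. -}

module Defs where

open import Data.Nat using (ℕ; suc; _<_; _≤_; _≥_)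
open import Data.Integer using (ℤ; _-_; +_; -[1+_]) renaming (_≤_ to _≤ℤ_)
open import Data.Product using (_×_; Σ)
open import Data.Sum using (_⊎_)
open import Relation.Binary.PropositionalEquality using (_≡_)

-- Conventions: indices are 0-based, ranging over 0 … n-1 (the paper's 1 … n).
-- A matrix is a function ℕ → ℕ → ℤ; only entries with both indices < n matter.
Matrix : Set
Matrix = ℕ → ℕ → ℤ

UnitStep : ℤ → Set
UnitStep d = (d ≡ -[1+ 0 ]) ⊎ (d ≡ + 0) ⊎ (d ≡ + 1)

-- Full n×n unit-Monge matrix (paper indices 1 ≤ i < n ↔ here i with suc i < n).
UnitMonge : ℕ → Matrix → Set
UnitMonge n M =
  (∀ i j → suc i < n → suc j < n →
     (M (suc i) j - M i j) ≤ℤ (M (suc i) (suc j) - M i (suc j)))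
  × (∀ i j → suc i < n → j < n → UnitStep (M (suc i) j - M i j))

data Shape : Set where
  lower upper : Shape

Defined : Shape → ℕ → ℕ → Set
Defined lower i j = j ≤ i
Defined upper i j = i ≤ j

-- The hypotheses on a partially defined n×n matrix of the given shape:
-- entries at undefined positions are ignored (they are never referenced).
PartialUnitMonge : Shape → ℕ → Matrix → Set
PartialUnitMonge s n M =
  (∀ i j → suc i < n → j < n → Defined s i j → Defined s (suc i) j →
     UnitStep (M (suc i) j - M i j))
  × (∀ i j → suc i < n → suc j < n →
       Defined s i j → Defined s (suc i) j →
       Defined s i (suc j) → Defined s (suc i) (suc j) →
       (M (suc i) j - M i j) ≤ℤ (M (suc i) (suc j) - M i (suc j)))

Extends : Shape → ℕ → Matrix → Matrix → Set
Extends s n M N = ∀ i j → i < n → j < n → Defined s i j → N i j ≡ M i j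

module Submission where

-- A full matrix N is unit-Monge exactly when its row differences
-- D i j = N (i+1) j - N i j lie in {-1,0,1} and are non-decreasing in j.
-- We complete a partial matrix M of either shape by one uniform rule: an
-- undefined entry (i , j) gets  M j j - |i - j| , i.e. we walk away from the
-- diagonal entry of column j along the column, losing 1 per step.
--   * lower shape (defined iff j ≤ i): above the diagonal D i j = +1,
--     the largest unit step, so monotonicity in j can only fail where it is
--     inherited from M;
--   * upper shape (defined iff i ≤ j): below the diagonal D i j = -1,
--     the smallest unit step, with the symmetric effect.

open import Defs
open import Data.Nat using (ℕ; zero; suc; ∣_-_∣; _≤?_; z≤n; s≤s)
  renaming (_≤_ to _≤ℕ_; _<_ to _<ℕ_)
open import Data.Nat.Properties using (≤-antisym; <⇒≤; m≤n⇒m≤1+n; ≤-<-connex; <-≤-connex; ∣n-n∣≡0; ∣-∣-comm)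
open import Data.Integer using (ℤ; +_; -[1+_]; _-_; _+_) renaming (_≤_ to _≤ℤ_)
open import Data.Integer.Properties using (pos-+; +-identityʳ)
import Data.Integer as ℤ
open import Data.Integer.Tactic.RingSolver using (solve-∀)
open import Data.Product using (Σ; _×_; _,_)
open import Data.Sum using (inj₁; inj₂)
open import Relation.Nullary using (Dec; yes; no)
open import Relation.Nullary.Negation using (contradiction)
open import Relation.Binary.PropositionalEquality using (_≡_; refl; sym; cong; cong₂)
open Relation.Binary.PropositionalEquality.≡-Reasoning

rowDiff : Matrix → ℕ → ℕ → ℤ
rowDiff N i j = N (suc i) j - N i j

unitStep-≤1 : ∀ {d} → UnitStep d → d ≤ℤ + 1
unitStep-≤1 (inj₁ refl)        = ℤ.-≤+
unitStep-≤1 (inj₂ (inj₁ refl)) = ℤ.+≤+ z≤n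
unitStep-≤1 (inj₂ (inj₂ refl)) = ℤ.+≤+ (s≤s z≤n)

unitStep-≥-1 : ∀ {d} → UnitStep d → -[1+ 0 ] ≤ℤ d
unitStep-≥-1 (inj₁ refl)        = ℤ.-≤- z≤n
unitStep-≥-1 (inj₂ (inj₁ refl)) = ℤ.-≤+
unitStep-≥-1 (inj₂ (inj₂ refl)) = ℤ.-≤+

∣m-1+n∣ : ∀ {m n} → m ≤ℕ n → ∣ m - suc n ∣ ≡ suc ∣ m - n ∣
∣m-1+n∣ {zero}          z≤n       = refl
∣m-1+n∣ {suc m} {suc n} (s≤s m≤n) = ∣m-1+n∣ m≤n

step-down : ∀ (a : ℤ) k → (a - + k) - (a - + suc k) ≡ + 1
step-down a k rewrite pos-+ 1 k = identity a (+ k)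
  where identity : ∀ (a b : ℤ) → (a - b) - (a - (+ 1 + b)) ≡ + 1
        identity = solve-∀

step-up : ∀ (a : ℤ) k → (a - + suc k) - (a - + k) ≡ -[1+ 0 ]
step-up a k rewrite pos-+ 1 k = identity a (+ k)
  where identity : ∀ (a b : ℤ) → (a - (+ 1 + b)) - (a - b) ≡ -[1+ 0 ]
        identity = solve-∀

opposite : Shape → Shape
opposite lower = upper
opposite upper = lower

on-both-sides⇒diagonal : ∀ s {i j} → Defined s i j → Defined (opposite s) i j → i ≡ j
on-both-sides⇒diagonal lower j≤i i≤j = ≤-antisym i≤j j≤i
on-both-sides⇒diagonal upper i≤j j≤i = ≤-antisym i≤j j≤i

defined? : ∀ s i j → Dec (Defined s i j)
defined? lower i j = j ≤? i
defined? upper i j = i ≤? j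

fill : Shape → Matrix → Matrix
fill s M i j with defined? s i j
... | yes _ = M i j
... | no _  = M j j - + ∣ i - j ∣

fill-defined : ∀ s M {i j} → Defined s i j → fill s M i j ≡ M i j
fill-defined s M {i} {j} d with defined? s i j
... | yes _ = refl
... | no ¬d = contradiction d ¬d

fill-opposite : ∀ s M {i j} → Defined (opposite s) i j → fill s M i j ≡ M j j - + ∣ i - j ∣
fill-opposite s M {i} {j} o with defined? s i j
... | no _  = refl
... | yes d with on-both-sides⇒diagonal s d o
...   | refl rewrite ∣n-n∣≡0 i = sym (+-identityʳ (M i i))

rowDiff-fill-defined : ∀ s M {i j} → Defined s i j → Defined s (suc i) j →
  rowDiff (fill s M) i j ≡ rowDiff M i j
rowDiff-fill-defined s M d d′ rewrite fill-defined s M d | fill-defined s M d′ = refl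

rowDiff-fill-lower : ∀ M {i j} → i <ℕ j → rowDiff (fill lower M) i j ≡ + 1
rowDiff-fill-lower M {i} {suc j} (s≤s i≤j) = begin
  fill lower M (suc i) (suc j) - fill lower M i (suc j)
    ≡⟨ cong₂ _-_ (fill-opposite lower M (s≤s i≤j)) (fill-opposite lower M (m≤n⇒m≤1+n i≤j)) ⟩
  (M (suc j) (suc j) - + ∣ i - j ∣) - (M (suc j) (suc j) - + ∣ i - suc j ∣)
    ≡⟨ cong (λ k → (M (suc j) (suc j) - + ∣ i - j ∣) - (M (suc j) (suc j) - + k)) (∣m-1+n∣ i≤j) ⟩
  (M (suc j) (suc j) - + ∣ i - j ∣) - (M (suc j) (suc j) - + suc ∣ i - j ∣)
    ≡⟨ step-down (M (suc j) (suc j)) ∣ i - j ∣ ⟩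
  + 1 ∎

rowDiff-fill-upper : ∀ M {i j} → j ≤ℕ i → rowDiff (fill upper M) i j ≡ -[1+ 0 ]
rowDiff-fill-upper M {i} {j} j≤i = begin
  fill upper M (suc i) j - fill upper M i j
    ≡⟨ cong₂ _-_ (fill-opposite upper M (m≤n⇒m≤1+n j≤i)) (fill-opposite upper M j≤i) ⟩
  (M j j - + ∣ suc i - j ∣) - (M j j - + ∣ i - j ∣)
    ≡⟨ cong (λ k → (M j j - + k) - (M j j - + ∣ i - j ∣)) distance-grows ⟩
  (M j j - + suc ∣ i - j ∣) - (M j j - + ∣ i - j ∣)
    ≡⟨ step-up (M j j) ∣ i - j ∣ ⟩
  -[1+ 0 ] ∎
  where
    distance-grows : ∣ suc i - j ∣ ≡ suc ∣ i - j ∣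
    distance-grows = begin
      ∣ suc i - j ∣   ≡⟨ ∣-∣-comm (suc i) j ⟩
      ∣ j - suc i ∣   ≡⟨ ∣m-1+n∣ j≤i ⟩
      suc ∣ j - i ∣   ≡⟨ cong suc (∣-∣-comm j i) ⟩
      suc ∣ i - j ∣   ∎

unitStep-fill-lower : ∀ n M → PartialUnitMonge lower n M →
  ∀ i j → suc i <ℕ n → j <ℕ n → UnitStep (rowDiff (fill lower M) i j)
unitStep-fill-lower n M (unit , _) i j i+1<n j<n with ≤-<-connex j i
... | inj₁ j≤i rewrite rowDiff-fill-defined lower M j≤i (m≤n⇒m≤1+n j≤i) =
  unit i j i+1<n j<n j≤i (m≤n⇒m≤1+n j≤i)
... | inj₂ i<j rewrite rowDiff-fill-lower M i<j = inj₂ (inj₂ refl)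

-- Monge condition of the lower completion: inherited from M when the four
-- entries are defined; otherwise the right-hand step is +1, the maximum.
monge-fill-lower : ∀ n M → PartialUnitMonge lower n M →
  ∀ i j → suc i <ℕ n → suc j <ℕ n →
  rowDiff (fill lower M) i j ≤ℤ rowDiff (fill lower M) i (suc j)
monge-fill-lower n M h@(_ , monge) i j i+1<n j+1<n with <-≤-connex j i
... | inj₁ j<i
  rewrite rowDiff-fill-defined lower M (<⇒≤ j<i) (m≤n⇒m≤1+n (<⇒≤ j<i))
        | rowDiff-fill-defined lower M j<i (m≤n⇒m≤1+n j<i) =
  monge i j i+1<n j+1<n (<⇒≤ j<i) (m≤n⇒m≤1+n (<⇒≤ j<i)) j<i (m≤n⇒m≤1+n j<i)
... | inj₂ i≤j rewrite rowDiff-fill-lower M (s≤s i≤j) =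
  unitStep-≤1 (unitStep-fill-lower n M h i j i+1<n (<⇒≤ j+1<n))

unitStep-fill-upper : ∀ n M → PartialUnitMonge upper n M →
  ∀ i j → suc i <ℕ n → j <ℕ n → UnitStep (rowDiff (fill upper M) i j)
unitStep-fill-upper n M (unit , _) i j i+1<n j<n with <-≤-connex i j
... | inj₁ i<j rewrite rowDiff-fill-defined upper M (<⇒≤ i<j) i<j =
  unit i j i+1<n j<n (<⇒≤ i<j) i<j
... | inj₂ j≤i rewrite rowDiff-fill-upper M j≤i = inj₁ refl

-- Monge condition of the upper completion: inherited from M when the four
-- entries are defined; otherwise the left-hand step is -1, the minimum.
monge-fill-upper : ∀ n M → PartialUnitMonge upper n M →
  ∀ i j → suc i <ℕ n → suc j <ℕ n →
  rowDiff (fill upper M) i j ≤ℤ rowDiff (fill upper M) i (suc j)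
monge-fill-upper n M h@(_ , monge) i j i+1<n j+1<n with <-≤-connex i j
... | inj₁ i<j
  rewrite rowDiff-fill-defined upper M (<⇒≤ i<j) i<j
        | rowDiff-fill-defined upper M (m≤n⇒m≤1+n (<⇒≤ i<j)) (m≤n⇒m≤1+n i<j) =
  monge i j i+1<n j+1<n (<⇒≤ i<j) i<j (m≤n⇒m≤1+n (<⇒≤ i<j)) (m≤n⇒m≤1+n i<j)
... | inj₂ j≤i rewrite rowDiff-fill-upper M j≤i =
  unitStep-≥-1 (unitStep-fill-upper n M h i (suc j) i+1<n j+1<n)

fill-unitMonge : ∀ s n M → PartialUnitMonge s n M → UnitMonge n (fill s M)
fill-unitMonge lower n M h = monge-fill-lower n M h , unitStep-fill-lower n M h
fill-unitMonge upper n M h = monge-fill-upper n M h , unitStep-fill-upper n M h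

lemma5 : (s : Shape) (n : ℕ) (M : Matrix) → PartialUnitMonge s n M →
    Σ Matrix (λ N → Extends s n M N × UnitMonge n N)
lemma5 s n M h = fill s M , (λ _ _ _ _ d → fill-defined s M d) , fill-unitMonge s n M h
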